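{- Let $G$ and $H$ be finite simple graphs with ${\rm diam}(G)=2$. Then $$\chi_{\rho}(G\circ H)=|G|\cdot|H|-\alpha(G)\alpha(H)+1.$$
   Context: $|G|$ denotes the number of vertices, ${\rm diam}(G)$ the diameter and $\alpha(G)$ the independence number. A $k$-packing coloring of a graph is a map $c:V\to\{1,\dots,k\}$ such that two distinct vertices with $c(u)=c(v)=i$ are at distance more than $i$; the packing chromatic number $\chi_\rho$ is the least such $k$. The lexicographic product $G\circ H$ has vertex set $V(G)\times V(H)$, with $(g_1,h_1)\sim(g_2,h_2)$ iff $g_1g_2\in E(G)$, or $g_1=g_2$ and $h_1h_2\in E(H)$. -}

module Defs where

open import Data.Nat using (ℕ; zero; suc; _*_; _≤_)
open import Data.Fin using (Fin; toℕ; quotient; remainder)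
open import Data.Fin.Subset using (Subset; _∈_; ∣_∣)
open import Data.Product using (Σ; ∃; ∃-syntax; _×_; _,_)
open import Data.Sum using (_⊎_)
open import Relation.Binary.PropositionalEquality using (_≡_; _≢_)
open import Relation.Nullary using (¬_)

record Graph : Set₁ where
  field
    n     : ℕ
    Adj   : Fin n → Fin n → Set
    sym   : ∀ {u v} → Adj u v → Adj v u
    irrefl : ∀ {u} → ¬ Adj u u

open Graph public

order : Graph → ℕ
order G = n G

data Walk (G : Graph) : ℕ → Fin (n G) → Fin (n G) → Set where
  here : ∀ {u} → Walk G zero u u
  step : ∀ {k u v w} → Adj G u v → Walk G k v w → Walk G (suc k) u w

DistLE : (G : Graph) → Fin (n G) → Fin (n G) → ℕ → Set
DistLE G u v d = ∃[ k ] (k ≤ d × Walk G k u v)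

HasDiameter : Graph → ℕ → Set
HasDiameter G zero = (∀ u v → DistLE G u v zero)
HasDiameter G (suc d) =
  (∀ u v → DistLE G u v (suc d)) × (∃[ u ] ∃[ v ] ¬ DistLE G u v d)

Independent : (G : Graph) → Subset (n G) → Set
Independent G S = ∀ {u v} → u ∈ S → v ∈ S → ¬ Adj G u v

IsIndependenceNumber : Graph → ℕ → Set
IsIndependenceNumber G a =
  (∃[ S ] (Independent G S × ∣ S ∣ ≡ a)) ×
  (∀ S → Independent G S → ∣ S ∣ ≤ a)

-- k-packing colouring; colour i ∈ {1,…,k} is represented by c v : Fin k with
-- i = toℕ (c v) + 1.  Equal colour i ⇒ distance > i.
IsPackingColoring : (G : Graph) (k : ℕ) → (Fin (n G) → Fin k) → Set
IsPackingColoring G k c =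
  ∀ u v → u ≢ v → c u ≡ c v → ¬ DistLE G u v (suc (toℕ (c u)))

HasPackingColoring : Graph → ℕ → Set
HasPackingColoring G k = ∃[ c ] IsPackingColoring G k c

IsPackingChromaticNumber : Graph → ℕ → Set
IsPackingChromaticNumber G k =
  HasPackingColoring G k × (∀ m → HasPackingColoring G m → k ≤ m)

-- lexicographic product G ∘ H on Fin (|G| * |H|); vertex x corresponds to the
-- pair (quotient x, remainder x) ∈ V(G) × V(H) (a bijection, inverse combine).
-- the two coordinates of a vertex of G ∘ H
fstV : (G H : Graph) → Fin (n G * n H) → Fin (n G)
fstV G H x = quotient {n G} (n H) x

sndV : (G H : Graph) → Fin (n G * n H) → Fin (n H)
sndV G H x = remainder {n G} (n H) x

lexAdj : (G H : Graph) → Fin (n G * n H) → Fin (n G * n H) → Set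
lexAdj G H x y =
  Adj G (fstV G H x) (fstV G H y) ⊎
  (fstV G H x ≡ fstV G H y × Adj H (sndV G H x) (sndV G H y))

lexProduct : Graph → Graph → Graph
lexProduct G H = record
  { n = n G * n H
  ; Adj = lexAdj G H
  ; sym = λ { (_⊎_.inj₁ a) → _⊎_.inj₁ (sym G a)
            ; (_⊎_.inj₂ (e , a)) → _⊎_.inj₂ (Eq.sym e , sym H a) }
  ; irrefl = λ { (_⊎_.inj₁ a) → irrefl G a
               ; (_⊎_.inj₂ (_ , a)) → irrefl H a } }
  where import Relation.Binary.PropositionalEquality as Eq

-- In a graph of diameter at most 2 any two vertices are within distance 2, so a colour
-- other than 1 occurs at most once, while the vertices of colour 1 form an independent set.
-- Hence χ_ρ = |V| - α + 1, attained by giving a maximum independent set colour 1 and all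
-- other vertices distinct colours.  Since diam G = 2, G has no isolated vertex, so G ∘ H
-- again has diameter at most 2; and α(G ∘ H) = α(G) α(H), because an independent set of
-- G ∘ H projects onto an independent set of G and meets each copy of H independently.
module Submission where

open import Defs
open import Data.Nat using (ℕ; zero; suc; _*_; _∸_; _+_; _≤_; _<_; z≤n; s≤s; s≤s⁻¹)
open import Data.Nat.Properties
  using (≤-trans; ≤-refl; +-mono-≤; +-comm; *-monoˡ-≤; ∸-monoʳ-≤; module ≤-Reasoning)
open import Data.Bool using (if_then_else_)
open import Data.Fin as Fin using (Fin; zero; suc; toℕ; combine; quotient; remainder; _≟_)
open import Data.Fin.Properties
  using (¬Fin0; suc-injective; injective⇒≤; remQuot-combine; combine-remQuot)
open import Data.Fin.Subset using (Subset; inside; outside; _∈_; ∁; ⊥; ∣_∣; Nonempty)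
open import Data.Fin.Subset.Properties
  using (_∈?_; nonempty?; Empty-unique; ∣⊥∣≡0; ∉⊥; ∣∁p∣≡n∸∣p∣; x∉p⇒x∈∁p; x∈∁p⇒x∉p)
open import Data.Vec using (Vec; []; _∷_; _++_; concat; map; lookup; tabulate; here; there; group)
open import Data.Vec.Properties
  using (lookup-concat; lookup-map; lookup∘tabulate; []=⇒lookup; lookup⇒[]=)
open import Data.Product using (∃-syntax; _×_; _,_; proj₁; proj₂)
open import Data.Sum using (inj₁; inj₂)
open import Relation.Nullary using (¬_; Dec; yes; no; does; contradiction)
open import Relation.Nullary.Decidable using (dec-true)
open import Relation.Unary using (Pred; Decidable)
open import Function using (_∘_)
open import Relation.Binary.PropositionalEquality as ≡
  using (_≡_; _≢_; refl; trans; cong; cong₂; subst; subst₂; module ≡-Reasoning)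

∣p++q∣≡∣p∣+∣q∣ : ∀ {m k} (p : Subset m) (q : Subset k) → ∣ p ++ q ∣ ≡ ∣ p ∣ + ∣ q ∣
∣p++q∣≡∣p∣+∣q∣ []            q = refl
∣p++q∣≡∣p∣+∣q∣ (inside  ∷ p) q = cong suc (∣p++q∣≡∣p∣+∣q∣ p q)
∣p++q∣≡∣p∣+∣q∣ (outside ∷ p) q = ∣p++q∣≡∣p∣+∣q∣ p q

support : ∀ {m k} → Vec (Subset k) m → Subset m
support []       = []
support (r ∷ rs) = does (nonempty? r) ∷ support rs

∈-support⇒Nonempty : ∀ {m k} (rs : Vec (Subset k) m) {g} → g ∈ support rs →
  Nonempty (lookup rs g)
∈-support⇒Nonempty (r ∷ rs) {zero} g∈ with nonempty? r
... | yes r-nonempty = r-nonempty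
∈-support⇒Nonempty (r ∷ rs) {suc g} (there g∈) = ∈-support⇒Nonempty rs g∈

∣concat∣≤∣support∣* : ∀ {m k} b (rs : Vec (Subset k) m) → (∀ g → ∣ lookup rs g ∣ ≤ b) →
  ∣ concat rs ∣ ≤ ∣ support rs ∣ * b
∣concat∣≤∣support∣* b []       _      = z≤n
∣concat∣≤∣support∣* {k = k} b (r ∷ rs) ∣rs∣≤b with nonempty? r
... | yes _ = begin
  ∣ r ++ concat rs ∣                ≡⟨ ∣p++q∣≡∣p∣+∣q∣ r (concat rs) ⟩
  ∣ r ∣ + ∣ concat rs ∣             ≤⟨ +-mono-≤ (∣rs∣≤b zero) (∣concat∣≤∣support∣* b rs (∣rs∣≤b ∘ suc)) ⟩
  b + ∣ support rs ∣ * b            ∎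
  where open ≤-Reasoning
... | no r-empty = begin
  ∣ r ++ concat rs ∣                ≡⟨ ∣p++q∣≡∣p∣+∣q∣ r (concat rs) ⟩
  ∣ r ∣ + ∣ concat rs ∣             ≡⟨ cong (λ r → ∣ r ∣ + ∣ concat rs ∣) (Empty-unique r-empty) ⟩
  ∣ ⊥ {k} ∣ + ∣ concat rs ∣         ≡⟨ cong (_+ ∣ concat rs ∣) (∣⊥∣≡0 k) ⟩
  ∣ concat rs ∣                     ≤⟨ ∣concat∣≤∣support∣* b rs (∣rs∣≤b ∘ suc) ⟩
  ∣ support rs ∣ * b                ∎
  where open ≤-Reasoning

∈-concat⁺ : ∀ {m k} (rs : Vec (Subset k) m) {g h} → h ∈ lookup rs g →
  combine g h ∈ concat rs
∈-concat⁺ rs {g} {h} h∈ = lookup⇒[]= _ (concat rs) (trans (lookup-concat rs g h) ([]=⇒lookup h∈))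

∈-concat⁻ : ∀ {m k} (rs : Vec (Subset k) m) {x} → x ∈ concat rs →
  remainder {m} k x ∈ lookup rs (quotient {m} k x)
∈-concat⁻ {m} {k} rs {x} x∈ = lookup⇒[]= _ _ (begin
  lookup (lookup rs q) r          ≡⟨ lookup-concat rs q r ⟨
  lookup (concat rs) (combine q r) ≡⟨ cong (lookup (concat rs)) (combine-remQuot {m} k x) ⟩
  lookup (concat rs) x             ≡⟨ []=⇒lookup x∈ ⟩
  inside                           ∎)
  where
  open ≡-Reasoning
  q = quotient {m} k x
  r = remainder {m} k x

infixr 7 _⊗_
_⊗_ : ∀ {m k} → Subset m → Subset k → Subset (m * k)
S ⊗ T = concat (map (λ s → if s then T else ⊥) S)

∣S⊗T∣≡∣S∣*∣T∣ : ∀ {m k} (S : Subset m) (T : Subset k) → ∣ S ⊗ T ∣ ≡ ∣ S ∣ * ∣ T ∣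
∣S⊗T∣≡∣S∣*∣T∣         []            T = refl
∣S⊗T∣≡∣S∣*∣T∣         (inside  ∷ S) T =
  trans (∣p++q∣≡∣p∣+∣q∣ T (S ⊗ T)) (cong (∣ T ∣ +_) (∣S⊗T∣≡∣S∣*∣T∣ S T))
∣S⊗T∣≡∣S∣*∣T∣ {k = k} (outside ∷ S) T =
  trans (∣p++q∣≡∣p∣+∣q∣ (⊥ {k}) (S ⊗ T)) (cong₂ _+_ (∣⊥∣≡0 k) (∣S⊗T∣≡∣S∣*∣T∣ S T))

∈-⊗⁻ : ∀ {m k} (S : Subset m) (T : Subset k) {x} → x ∈ S ⊗ T →
  quotient {m} k x ∈ S × remainder {m} k x ∈ T
∈-⊗⁻ {m} {k} S T {x} x∈
  with r∈ ← ∈-concat⁻ (map (λ s → if s then T else ⊥) S) x∈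
  rewrite lookup-map (quotient {m} k x) (λ s → if s then T else ⊥) S
  with lookup S (quotient {m} k x) in q∈S
... | inside  = lookup⇒[]= _ S q∈S , r∈
... | outside = contradiction r∈ ∉⊥

rank : ∀ {m} {p : Subset m} {x} → x ∈ p → Fin ∣ p ∣
rank here                       = zero
rank (there {y = inside}  x∈p) = suc (rank x∈p)
rank (there {y = outside} x∈p) = rank x∈p

rank-injective : ∀ {m} {p : Subset m} {x y} (x∈p : x ∈ p) (y∈p : y ∈ p) →
  rank x∈p ≡ rank y∈p → x ≡ y
rank-injective here                      here                      _ = refl
rank-injective (there {y = inside}  x∈p) (there {y = inside}  y∈p) e =
  cong suc (rank-injective x∈p y∈p (suc-injective e))
rank-injective (there {y = outside} x∈p) (there {y = outside} y∈p) e =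
  cong suc (rank-injective x∈p y∈p e)

enum : ∀ {m} (p : Subset m) → Fin ∣ p ∣ → Fin m
enum (inside  ∷ p) zero    = zero
enum (inside  ∷ p) (suc i) = suc (enum p i)
enum (outside ∷ p) i       = suc (enum p i)

enum-∈ : ∀ {m} (p : Subset m) i → enum p i ∈ p
enum-∈ (inside  ∷ p) zero    = here
enum-∈ (inside  ∷ p) (suc i) = there (enum-∈ p i)
enum-∈ (outside ∷ p) i       = there (enum-∈ p i)

enum-injective : ∀ {m} (p : Subset m) {i j} → enum p i ≡ enum p j → i ≡ j
enum-injective (inside  ∷ p) {zero}  {zero}  _ = refl
enum-injective (inside  ∷ p) {suc i} {suc j} e = cong suc (enum-injective p (suc-injective e))
enum-injective (outside ∷ p)                 e = enum-injective p (suc-injective e)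

injectiveOn⇒∣p∣<m : ∀ {N m} {p : Subset N} (f : Fin N → Fin m) (y : Fin m) →
  (∀ {u v} → u ∈ p → v ∈ p → f u ≡ f v → u ≡ v) → (∀ {u} → u ∈ p → f u ≢ y) →
  ∣ p ∣ < m
injectiveOn⇒∣p∣<m {p = p} f y f-injective f-avoids = injective⇒≤ {f = g} g-injective
  where
  g : Fin (suc ∣ p ∣) → Fin _
  g zero    = y
  g (suc i) = f (enum p i)
  g-injective : ∀ {i j} → g i ≡ g j → i ≡ j
  g-injective {zero}  {zero}  _ = refl
  g-injective {zero}  {suc j} e = contradiction (≡.sym e) (f-avoids (enum-∈ p j))
  g-injective {suc i} {zero}  e = contradiction e (f-avoids (enum-∈ p i))
  g-injective {suc i} {suc j} e =
    cong suc (enum-injective p (f-injective (enum-∈ p i) (enum-∈ p j) e))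

setOf : ∀ {m ℓ} {P : Pred (Fin m) ℓ} → Decidable P → Subset m
setOf P? = tabulate (does ∘ P?)

∈-setOf⁺ : ∀ {m ℓ} {P : Pred (Fin m) ℓ} (P? : Decidable P) {x} → P x → x ∈ setOf P?
∈-setOf⁺ P? {x} px = lookup⇒[]= x _ (trans (lookup∘tabulate _ x) (dec-true (P? x) px))

∈-setOf⁻ : ∀ {m ℓ} {P : Pred (Fin m) ℓ} (P? : Decidable P) {x} → x ∈ setOf P? → P x
∈-setOf⁻ P? {x} x∈
  with P? x | trans (≡.sym (lookup∘tabulate (does ∘ P?) x)) ([]=⇒lookup x∈)
... | yes px | _ = px

DiameterAtMost : Graph → ℕ → Set
DiameterAtMost G d = ∀ u v → DistLE G u v d

module _ (G : Graph) where

  walk-zero : ∀ {u v} → Walk G 0 u v → u ≡ v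
  walk-zero here = refl

  adjacent⇒distinct : ∀ {u v} → Adj G u v → u ≢ v
  adjacent⇒distinct adj refl = irrefl G adj

  adjacent⇒dist≤1 : ∀ {u v} → Adj G u v → DistLE G u v 1
  adjacent⇒dist≤1 adj = 1 , ≤-refl , step adj here

  dist≤1⇒adjacent : ∀ {u v} → u ≢ v → DistLE G u v 1 → Adj G u v
  dist≤1⇒adjacent u≢v (zero  , _ , w)              = contradiction (walk-zero w) u≢v
  dist≤1⇒adjacent u≢v (suc _ , s≤s z≤n , step a here) = a

  dist-weaken : ∀ {u v d d′} → d ≤ d′ → DistLE G u v d → DistLE G u v d′
  dist-weaken d≤d′ (k , k≤d , w) = k , ≤-trans k≤d d≤d′ , w

  distinct⇒positiveWalk : ∀ {u v d} → u ≢ v → DistLE G u v d →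
    ∃[ k ] (suc k ≤ d × Walk G (suc k) u v)
  distinct⇒positiveWalk u≢v (zero  , _    , w) = contradiction (walk-zero w) u≢v
  distinct⇒positiveWalk _   (suc k , k<d , w) = k , k<d , w

module _ (G : Graph) {Q : Subset (n G)} (Q-independent : Independent G Q) where

  private
    colourOf : ∀ x → Dec (x ∈ Q) → Fin (suc ∣ ∁ Q ∣)
    colourOf x (yes _)   = zero
    colourOf x (no  x∉Q) = suc (rank (x∉p⇒x∈∁p x∉Q))

    colourOf-packing : ∀ u v (u? : Dec (u ∈ Q)) (v? : Dec (v ∈ Q)) → u ≢ v →
      colourOf u u? ≡ colourOf v v? → ¬ DistLE G u v (suc (toℕ (colourOf u u?)))
    colourOf-packing u v (yes u∈Q) (yes v∈Q) u≢v _ d =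
      Q-independent u∈Q v∈Q (dist≤1⇒adjacent G u≢v d)
    colourOf-packing u v (no u∉Q) (no v∉Q) u≢v e _ =
      u≢v (rank-injective (x∉p⇒x∈∁p u∉Q) (x∉p⇒x∈∁p v∉Q) (suc-injective e))

  independent⇒packingColouring : HasPackingColoring G (suc ∣ ∁ Q ∣)
  independent⇒packingColouring =
    (λ x → colourOf x (x ∈? Q)) , λ u v → colourOf-packing u v (u ∈? Q) (v ∈? Q)

1≤toℕ : ∀ {m} {i : Fin (suc m)} → i ≢ zero → 1 ≤ toℕ i
1≤toℕ {i = zero}  i≢0 = contradiction refl i≢0
1≤toℕ {i = suc _} _   = s≤s z≤n

module _ (G : Graph) (diam≤2 : DiameterAtMost G 2) {α : ℕ}
         (α-bound : ∀ S → Independent G S → ∣ S ∣ ≤ α) (v₀ : Fin (n G)) where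

  packingColouring-lowerBound : ∀ m → HasPackingColoring G m → suc (n G ∸ α) ≤ m
  packingColouring-lowerBound zero    (c , _)       = contradiction (c v₀) ¬Fin0
  packingColouring-lowerBound (suc m) (c , packing) = s≤s (begin
    n G ∸ α      ≤⟨ ∸-monoʳ-≤ (n G) (α-bound Z Z-independent) ⟩
    n G ∸ ∣ Z ∣  ≡⟨ ∣∁p∣≡n∸∣p∣ Z ⟨
    ∣ ∁ Z ∣      ≤⟨ s≤s⁻¹ (injectiveOn⇒∣p∣<m c zero c-injective-on-∁Z ∁Z-nonzero) ⟩
    m            ∎)
    where
    open ≤-Reasoning
    zero? : ∀ x → Dec (c x ≡ zero)
    zero? x = c x ≟ zero

    Z : Subset (n G)
    Z = setOf zero?

    Z-independent : Independent G Z
    Z-independent u∈Z v∈Z adj =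
      packing _ _ (adjacent⇒distinct G adj)
        (trans (∈-setOf⁻ zero? u∈Z) (≡.sym (∈-setOf⁻ zero? v∈Z)))
        (dist-weaken G (s≤s z≤n) (adjacent⇒dist≤1 G adj))

    ∁Z-nonzero : ∀ {u} → u ∈ ∁ Z → c u ≢ zero
    ∁Z-nonzero u∈∁Z = x∈∁p⇒x∉p u∈∁Z ∘ ∈-setOf⁺ zero?

    c-injective-on-∁Z : ∀ {u v} → u ∈ ∁ Z → v ∈ ∁ Z → c u ≡ c v → u ≡ v
    c-injective-on-∁Z {u} {v} u∈∁Z _ e with u ≟ v
    ... | yes u≡v = u≡v
    ... | no  u≢v = contradiction
                      (dist-weaken G (s≤s (1≤toℕ (∁Z-nonzero u∈∁Z))) (diam≤2 u v))
                      (packing u v u≢v e)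

packingChromaticNumber-diam≤2 : (G : Graph) → DiameterAtMost G 2 → Fin (n G) →
  ∀ {α} → IsIndependenceNumber G α → IsPackingChromaticNumber G (n G ∸ α + 1)
packingChromaticNumber-diam≤2 G diam≤2 v₀ {α} ((Q , Q-independent , ∣Q∣≡α) , α-bound) =
  subst (IsPackingChromaticNumber G) (+-comm 1 (n G ∸ α))
    ( subst (HasPackingColoring G) (cong suc ∣∁Q∣≡n∸α)
        (independent⇒packingColouring G Q-independent)
    , packingColouring-lowerBound G diam≤2 α-bound v₀ )
  where
  ∣∁Q∣≡n∸α : ∣ ∁ Q ∣ ≡ n G ∸ α
  ∣∁Q∣≡n∸α = trans (∣∁p∣≡n∸∣p∣ Q) (cong (n G ∸_) ∣Q∣≡α)

module _ (G : Graph) (diam : HasDiameter G 2) where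

  anotherVertex : ∀ g → ∃[ o ] g ≢ o
  anotherVertex g with (u₀ , v₀ , far) ← proj₂ diam | g ≟ u₀
  ... | yes refl = v₀ , λ { refl → far (0 , z≤n , here) }
  ... | no  g≢u₀ = u₀ , g≢u₀

  hasNeighbour : ∀ g → ∃[ w ] Adj G g w
  hasNeighbour g with o , g≢o ← anotherVertex g
                 with _ , _ , step a _ ← distinct⇒positiveWalk G g≢o (proj₁ diam g o) = _ , a

  -- For g ≡ g′ this is the closed walk g, w, g: it is what puts two vertices of the
  -- same copy of H within distance 2 in G ∘ H.
  positiveWalk≤2 : ∀ g g′ → ∃[ k ] (suc k ≤ 2 × Walk G (suc k) g g′)
  positiveWalk≤2 g g′ with g ≟ g′
  ... | yes refl with (w , a) ← hasNeighbour g = 1 , ≤-refl , step a (step (sym G a) here)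
  ... | no  g≢g′ = distinct⇒positiveWalk G g≢g′ (proj₁ diam g g′)

module _ (G H : Graph) where

  fstV-combine : ∀ g h → fstV G H (combine g h) ≡ g
  fstV-combine g h = cong proj₁ (remQuot-combine {n G} {n H} g h)

  sndV-combine : ∀ g h → sndV G H (combine g h) ≡ h
  sndV-combine g h = cong proj₂ (remQuot-combine {n G} {n H} g h)

  lexAdj-fst : ∀ {g g′} h h′ → Adj G g g′ → lexAdj G H (combine g h) (combine g′ h′)
  lexAdj-fst {g} {g′} h h′ a =
    inj₁ (subst₂ (Adj G) (≡.sym (fstV-combine g h)) (≡.sym (fstV-combine g′ h′)) a)

  lexAdj-snd : ∀ g {h h′} → Adj H h h′ → lexAdj G H (combine g h) (combine g h′)
  lexAdj-snd g {h} {h′} a =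
    inj₂ ( trans (fstV-combine g h) (≡.sym (fstV-combine g h′))
         , subst₂ (Adj H) (≡.sym (sndV-combine g h)) (≡.sym (sndV-combine g h′)) a )

  ⊗-independent : ∀ {S T} → Independent G S → Independent H T →
    Independent (lexProduct G H) (S ⊗ T)
  ⊗-independent {S} {T} S-ind T-ind u∈ v∈ (inj₁ a) =
    S-ind (proj₁ (∈-⊗⁻ S T u∈)) (proj₁ (∈-⊗⁻ S T v∈)) a
  ⊗-independent {S} {T} S-ind T-ind u∈ v∈ (inj₂ (_ , a)) =
    T-ind (proj₂ (∈-⊗⁻ S T u∈)) (proj₂ (∈-⊗⁻ S T v∈)) a

  lex-independent-bound : ∀ {a b} → (∀ S → Independent G S → ∣ S ∣ ≤ a) →
    (∀ T → Independent H T → ∣ T ∣ ≤ b) →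
    ∀ X → Independent (lexProduct G H) X → ∣ X ∣ ≤ a * b
  lex-independent-bound {a} {b} α-G α-H X X-ind with rs , refl ← group (n G) (n H) X = begin
    ∣ concat rs ∣       ≤⟨ ∣concat∣≤∣support∣* b rs (λ g → α-H _ (row-independent g)) ⟩
    ∣ support rs ∣ * b  ≤⟨ *-monoˡ-≤ b (α-G _ support-independent) ⟩
    a * b               ∎
    where
    open ≤-Reasoning
    row-independent : ∀ g → Independent H (lookup rs g)
    row-independent g h∈ h′∈ a = X-ind (∈-concat⁺ rs h∈) (∈-concat⁺ rs h′∈) (lexAdj-snd g a)
    support-independent : Independent G (support rs)
    support-independent g∈ g′∈ a
      with (h , h∈) ← ∈-support⇒Nonempty rs g∈ | (h′ , h′∈) ← ∈-support⇒Nonempty rs g′∈ =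
      X-ind (∈-concat⁺ rs h∈) (∈-concat⁺ rs h′∈) (lexAdj-fst h h′ a)

  lex-independenceNumber : ∀ {a b} → IsIndependenceNumber G a → IsIndependenceNumber H b →
    IsIndependenceNumber (lexProduct G H) (a * b)
  lex-independenceNumber ((S , S-ind , ∣S∣≡a) , α-G) ((T , T-ind , ∣T∣≡b) , α-H) =
    ( S ⊗ T , ⊗-independent S-ind T-ind , trans (∣S⊗T∣≡∣S∣*∣T∣ S T) (cong₂ _*_ ∣S∣≡a ∣T∣≡b) )
    , lex-independent-bound α-G α-H

  liftWalk : ∀ {k x y} → Walk G (suc k) (fstV G H x) (fstV G H y) →
    Walk (lexProduct G H) (suc k) x y
  liftWalk (step a here) = step (inj₁ a) here
  liftWalk {x = x} (step {v = v} a w@(step _ _)) =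
    step (inj₁ (subst (Adj G _) v≡ a)) (liftWalk (subst (λ g → Walk G _ g _) v≡ w))
    where
    v≡ : v ≡ fstV G H (combine v (sndV G H x))
    v≡ = ≡.sym (fstV-combine v (sndV G H x))

  lex-diameter≤2 : HasDiameter G 2 → DiameterAtMost (lexProduct G H) 2
  lex-diameter≤2 diam x y with k , k<2 , w ← positiveWalk≤2 G diam (fstV G H x) (fstV G H y) =
    suc k , k<2 , liftWalk w

corollary2p4 : (G H : Graph) (a b : ℕ) →
    HasDiameter G 2 → 1 ≤ order H →
    IsIndependenceNumber G a → IsIndependenceNumber H b →
    IsPackingChromaticNumber (lexProduct G H) (order G * order H ∸ a * b + 1)
corollary2p4 G H a b diam 1≤∣H∣ α-G α-H =
  packingChromaticNumber-diam≤2 (lexProduct G H) (lex-diameter≤2 G H diam) v₀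
    (lex-independenceNumber G H α-G α-H)
  where
  v₀ : Fin (n G * n H)
  v₀ = combine (proj₁ (proj₂ diam)) (Fin.fromℕ< 1≤∣H∣)
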